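{- Let $v\in\mathbb{R}^m$ be a vector with at most $s\le m/2$ non-zero entries. For any positive integer $t\le s/8$, there are at least $\min\{\binom{m-1}{t-1},(s/(8t))^t\}$ distinct subsets $T\subseteq[m]$ of cardinality $|T|=t$ for which $\sum_{i\in T}v_i^2\ge t\|v\|_2^2/(2s)$. -}

module Defs where

open import Level using (0ℓ)
open import Data.Nat using (ℕ; zero; suc)
open import Data.Fin using (Fin)
import Data.Fin as F
open import Data.Vec using (Vec; []; _∷_)
open import Data.Bool using (true; false)
open import Data.Fin.Subset using (Subset)
open import Data.Product using (Σ; ∃; _×_)
open import Relation.Nullary using (¬_)
open import Relation.Binary.PropositionalEquality using (_≡_)
open import Relation.Binary.Structures using (IsTotalOrder)
open import Algebra.Structures using (IsCommutativeRing)

-- The real numbers, axiomatised as a (Dedekind-)complete ordered field.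
-- Any model is isomorphic to ℝ, so quantifying over models is
-- the same as talking about ℝ.
record RealField : Set₁ where
  infixl 6 _+_
  infixl 7 _*_
  infix 4 _≤_
  field
    Carrier : Set
    _+_ _*_ : Carrier → Carrier → Carrier
    -_ : Carrier → Carrier
    0# 1# : Carrier
    _≤_ : Carrier → Carrier → Set
    isCommutativeRing : IsCommutativeRing _≡_ _+_ _*_ -_ 0# 1#
    0≢1 : ¬ (0# ≡ 1#)
    inverse : ∀ x → ¬ (x ≡ 0#) → ∃ λ y → x * y ≡ 1#
    isTotalOrder : IsTotalOrder _≡_ _≤_
    +-mono-≤ : ∀ {x y} z → x ≤ y → x + z ≤ y + z
    *-nonneg : ∀ {x y} → 0# ≤ x → 0# ≤ y → 0# ≤ x * y
    lub : (P : Carrier → Set) → ∃ P → (∃ λ b → ∀ x → P x → x ≤ b) →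
          ∃ λ u → (∀ x → P x → x ≤ u) × (∀ b → (∀ x → P x → x ≤ b) → u ≤ b)

module Ops (R : RealField) where
  open RealField R

  fromℕ : ℕ → Carrier
  fromℕ zero = 0#
  fromℕ (suc n) = 1# + fromℕ n

  sumAll : ∀ {m} → (Fin m → Carrier) → Carrier
  sumAll {zero} f = 0#
  sumAll {suc m} f = f F.zero + sumAll (λ i → f (F.suc i))

  sumOver : ∀ {m} → Subset m → (Fin m → Carrier) → Carrier
  sumOver [] f = 0#
  sumOver (true ∷ T) f = f F.zero + sumOver T (λ i → f (F.suc i))
  sumOver (false ∷ T) f = sumOver T (λ i → f (F.suc i))

  normSq : ∀ {m} → (Fin m → Carrier) → Carrier
  normSq v = sumAll (λ i → v i * v i)

module Submission where

-- If some coordinate alone has 2s·v_i² ≥ t‖v‖², every t-set containing it qualifies, which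
-- gives C(m-1,t-1) sets. Otherwise 2s·v_i² ≤ t‖v‖² for every i, so every t-set T has
-- 2s·Σ_T v_i² ≤ t²‖v‖². Enlarge the support to a set S of size exactly s and double count over
-- the C(s,t) t-subsets of S: every index of S lies in C(s-1,t-1) of them, so the sums 2s·Σ_T v_i²
-- add up to 2t·C(s,t)‖v‖². Bounding the g heavy sets by t²‖v‖² and the others by t‖v‖² gives
-- C(s,t) ≤ g·t (or else v = 0, and then any coordinate is heavy), and (s/t)^t ≤ C(s,t) together
-- with t ≤ 8^t turns this into s^t ≤ (8t)^t·g. The hypothesis 8t ≤ s is only used as t ≤ s.

open import Defs
open import Level using (0ℓ)
open import Algebra.Bundles using (CommutativeRing)
open import Data.Bool using (Bool; true; false; T; T?)
open import Data.Nat using (ℕ; zero; suc; _+_; _*_; _^_; _∸_; _≤_; _<_; z≤n; s≤s; _≤?_; NonZero)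
open import Data.Nat.Properties
  using (≤-refl; ≤-reflexive; ≤-trans; ≤-antisym; <⇒≤; ≰⇒>; ≤-<-trans; module ≤-Reasoning;
         +-comm; +-suc; +-identityʳ; +-monoˡ-≤; +-monoˡ-<; m≤m+n; m<m+n; m+[n∸m]≡n;
         *-identityˡ; *-identityʳ; *-zeroʳ; *-suc; *-assoc; *-distribˡ-+;
         *-monoʳ-≤; *-monoˡ-≤; *-monoˡ-<; *-cancelˡ-≤; m≤n*m; ^-monoˡ-≤; m^n≢0)
open import Data.Nat.Combinatorics using (_C_; nC1≡n; nCk+nC[k+1]≡[n+1]C[k+1])
open import Data.Nat.Tactic.RingSolver using (solve-∀)
open import Data.Fin using (Fin; fromℕ<) renaming (zero to fzero; suc to fsuc)
open import Data.Fin.Subset using (Subset; ∣_∣; _∉_; _∈_; _⊆_; inside; outside; ⊤)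
open import Data.Fin.Subset.Properties using (s⊆s; out⊆; ⊆⊤; ∣⊤∣≡n; ⊆-refl)
open import Data.Vec using (Vec; []; _∷_; replicate; here; there)
open import Data.Vec.Properties using (∷-injectiveʳ)
open import Data.List using (List; []; _∷_; [_]; map; _++_; length; filter)
open import Data.List.Properties using (length-map; length-++)
open import Data.List.Membership.Propositional.Properties using (∈-map⁻)
open import Data.List.Relation.Unary.All as All using (All; []; _∷_)
import Data.List.Relation.Unary.All.Properties as All
open import Data.List.Relation.Unary.AllPairs using ([]; _∷_)
open import Data.List.Relation.Unary.Unique.Propositional using (Unique)
import Data.List.Relation.Unary.Unique.Propositional.Properties as Unique
open import Data.List.Relation.Binary.Disjoint.Propositional using (Disjoint)
open import Data.Product using (∃; _×_; _,_)
open import Data.Sum using (_⊎_; inj₁; inj₂; [_,_]′)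
open import Function using (const; _∘_)
open import Data.Empty using (⊥-elim)
open import Data.Unit using (tt)
open import Relation.Nullary using (¬_; Dec; yes; no)
open import Relation.Unary using (Decidable)
open import Relation.Binary.PropositionalEquality
  using (_≡_; refl; sym; trans; cong; cong₂; subst; subst₂; module ≡-Reasoning)
open import Relation.Binary.Structures using (IsTotalOrder)
open import Relation.Binary.Bundles using (Poset)
import Relation.Binary.Reasoning.PartialOrder as PosetReasoning

-- Binomial coefficients

C-absorption : ∀ n k → suc k * (suc n C suc k) ≡ suc n * (n C k)
C-absorption n zero = begin
  1 * (suc n C 1) ≡⟨ *-identityˡ (suc n C 1) ⟩
  suc n C 1       ≡⟨ nC1≡n (suc n) ⟩
  suc n           ≡⟨ *-identityʳ (suc n) ⟨
  suc n * 1       ∎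
  where open ≡-Reasoning
C-absorption zero (suc k) = *-zeroʳ (suc (suc k))
C-absorption (suc n) (suc k) = begin
  suc (suc k) * (suc (suc n) C suc (suc k))           ≡⟨ cong (suc (suc k) *_) (nCk+nC[k+1]≡[n+1]C[k+1] (suc n) (suc k)) ⟨
  suc (suc k) * (a′ + b′)                             ≡⟨ regroup (suc k) a′ b′ ⟩
  a′ + (suc k * a′ + suc (suc k) * b′)                ≡⟨ cong₂ (λ x y → a′ + (x + y)) (C-absorption n k) (C-absorption n (suc k)) ⟩
  a′ + (suc n * a + suc n * b)                        ≡⟨ cong (a′ +_) (*-distribˡ-+ (suc n) a b) ⟨
  a′ + suc n * (a + b)                                ≡⟨ cong (λ x → a′ + suc n * x) (nCk+nC[k+1]≡[n+1]C[k+1] n k) ⟩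
  suc (suc n) * a′                                    ∎
  where
  open ≡-Reasoning
  a = n C k
  b = n C suc k
  a′ = suc n C suc k
  b′ = suc n C suc (suc k)
  regroup : ∀ j x y → suc j * (x + y) ≡ x + (j * x + suc j * y)
  regroup = solve-∀

^-distribʳ-* : ∀ m n k → (m * n) ^ k ≡ m ^ k * n ^ k
^-distribʳ-* m n zero = refl
^-distribʳ-* m n (suc k) = begin
  m * n * (m * n) ^ k     ≡⟨ cong (m * n *_) (^-distribʳ-* m n k) ⟩
  m * n * (m ^ k * n ^ k) ≡⟨ interchange m n (m ^ k) (n ^ k) ⟩
  m * m ^ k * (n * n ^ k) ∎
  where
  open ≡-Reasoning
  interchange : ∀ a b c d → a * b * (c * d) ≡ a * c * (b * d)
  interchange = solve-∀

n^n≢0 : ∀ n → NonZero (n ^ n)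
n^n≢0 zero = _
n^n≢0 n@(suc _) = m^n≢0 n n

n^k≤k^k*nCk : ∀ {n k} → k ≤ n → n ^ k ≤ k ^ k * (n C k)
n^k≤k^k*nCk z≤n = ≤-refl
n^k≤k^k*nCk {suc n} {suc k} (s≤s k≤n) = begin
  suc n * suc n ^ k                  ≤⟨ *-monoʳ-≤ (suc n) [1+n]^k≤[1+k]^k*nCk ⟩
  suc n * (suc k ^ k * (n C k))      ≡⟨ x[yz]≡y[xz] (suc n) (suc k ^ k) (n C k) ⟩
  suc k ^ k * (suc n * (n C k))      ≡⟨ cong (suc k ^ k *_) (C-absorption n k) ⟨
  suc k ^ k * (suc k * (suc n C suc k)) ≡⟨ x[yz]≡y[xz] (suc k ^ k) (suc k) _ ⟩
  suc k * (suc k ^ k * (suc n C suc k)) ≡⟨ *-assoc (suc k) (suc k ^ k) _ ⟨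
  suc k ^ suc k * (suc n C suc k)    ∎
  where
  open ≤-Reasoning
  x[yz]≡y[xz] : ∀ x y z → x * (y * z) ≡ y * (x * z)
  x[yz]≡y[xz] = solve-∀
  k[1+n]≤[1+k]n : k * suc n ≤ suc k * n
  k[1+n]≤[1+k]n = begin
    k * suc n   ≡⟨ *-suc k n ⟩
    k + k * n   ≤⟨ +-monoˡ-≤ (k * n) k≤n ⟩
    suc k * n   ∎
  [1+n]^k≤[1+k]^k*nCk : suc n ^ k ≤ suc k ^ k * (n C k)
  [1+n]^k≤[1+k]^k*nCk = *-cancelˡ-≤ (k ^ k) {{n^n≢0 k}} (begin
    k ^ k * suc n ^ k               ≡⟨ ^-distribʳ-* k (suc n) k ⟨
    (k * suc n) ^ k                 ≤⟨ ^-monoˡ-≤ k k[1+n]≤[1+k]n ⟩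
    (suc k * n) ^ k                 ≡⟨ ^-distribʳ-* (suc k) n k ⟩
    suc k ^ k * n ^ k               ≤⟨ *-monoʳ-≤ (suc k ^ k) (n^k≤k^k*nCk k≤n) ⟩
    suc k ^ k * (k ^ k * (n C k))   ≡⟨ x[yz]≡y[xz] (suc k ^ k) (k ^ k) (n C k) ⟩
    k ^ k * (suc k ^ k * (n C k))   ∎)

n<m^n : ∀ {m} → 1 < m → ∀ n → n < m ^ n
n<m^n 1<m zero = s≤s z≤n
n<m^n {m} 1<m (suc n) = begin-strict
  suc n           ≤⟨ n<m^n 1<m n ⟩
  m ^ n           <⟨ m<m+n (m ^ n) (≤-<-trans z≤n (n<m^n 1<m n)) ⟩
  m ^ n + m ^ n   ≡⟨ cong (m ^ n +_) (+-identityʳ (m ^ n)) ⟨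
  2 * m ^ n       ≤⟨ *-monoˡ-≤ (m ^ n) 1<m ⟩
  m * m ^ n       ∎
  where open ≤-Reasoning

s^t≤[8t]^t*g : ∀ {s t g} → t ≤ s → s C t ≤ g * t → s ^ t ≤ (8 * t) ^ t * g
s^t≤[8t]^t*g {s} {t} {g} t≤s C≤gt = begin
  s ^ t                   ≤⟨ n^k≤k^k*nCk t≤s ⟩
  t ^ t * (s C t)         ≤⟨ *-monoʳ-≤ (t ^ t) C≤gt ⟩
  t ^ t * (g * t)         ≤⟨ *-monoʳ-≤ (t ^ t) (*-monoʳ-≤ g (<⇒≤ (n<m^n (s≤s (s≤s z≤n)) t))) ⟩
  t ^ t * (g * 8 ^ t)     ≡⟨ rearrange (t ^ t) g (8 ^ t) ⟩
  8 ^ t * t ^ t * g       ≡⟨ cong (_* g) (^-distribʳ-* 8 t t) ⟨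
  (8 * t) ^ t * g         ∎
  where
  open ≤-Reasoning
  rearrange : ∀ x y z → x * (y * z) ≡ z * x * y
  rearrange = solve-∀

gt<K⇒gt²+Kt<2tK : ∀ {g K} t .{{_ : NonZero t}} → g * t < K → g * (t * t) + K * t < 2 * (t * K)
gt<K⇒gt²+Kt<2tK {g} {K} t gt<K = begin-strict
  g * (t * t) + K * t   ≡⟨ cong (_+ K * t) (*-assoc g t t) ⟨
  g * t * t + K * t     <⟨ +-monoˡ-< (K * t) (*-monoˡ-< t gt<K) ⟩
  K * t + K * t         ≡⟨ twice K t ⟩
  2 * (t * K)           ∎
  where
  open ≤-Reasoning
  twice : ∀ a b → a * b + a * b ≡ 2 * (b * a)
  twice = solve-∀

-- Enumerating subsets

-- A pattern π : Vec Mark n describes the subsets containing every required position and no forbidden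
-- one; completions π k lists those containing exactly k optional positions.
data Mark : Set where
  required forbidden optional : Mark

completions : ∀ {n} → Vec Mark n → ℕ → List (Subset n)
completions []                zero    = [ [] ]
completions []                (suc k) = []
completions (required  ∷ π)   k       = map (inside ∷_) (completions π k)
completions (forbidden ∷ π)   k       = map (outside ∷_) (completions π k)
completions (optional  ∷ π)   zero    = map (outside ∷_) (completions π zero)
completions (optional  ∷ π)   (suc k) =
  map (outside ∷_) (completions π (suc k)) ++ map (inside ∷_) (completions π k)

#optional #required : ∀ {n} → Vec Mark n → ℕ
#optional []                = 0
#optional (optional  ∷ π)   = suc (#optional π)
#optional (required  ∷ π)   = #optional π
#optional (forbidden ∷ π)   = #optional π
#required []                = 0
#required (required  ∷ π)   = suc (#required π)
#required (optional  ∷ π)   = #required π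
#required (forbidden ∷ π)   = #required π

requiredSet : ∀ {n} → Vec Mark n → Subset n
requiredSet []              = []
requiredSet (required  ∷ π) = inside ∷ requiredSet π
requiredSet (optional  ∷ π) = outside ∷ requiredSet π
requiredSet (forbidden ∷ π) = outside ∷ requiredSet π

length-completions : ∀ {n} (π : Vec Mark n) k → length (completions π k) ≡ #optional π C k
length-completions []              zero    = refl
length-completions []              (suc k) = refl
length-completions (required  ∷ π) k       = trans (length-map _ (completions π k)) (length-completions π k)
length-completions (forbidden ∷ π) k       = trans (length-map _ (completions π k)) (length-completions π k)
length-completions (optional  ∷ π) zero    = trans (length-map _ (completions π zero)) (length-completions π zero)
length-completions (optional  ∷ π) (suc k) = begin
  length (map (outside ∷_) A ++ map (inside ∷_) B)       ≡⟨ length-++ (map (outside ∷_) A) ⟩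
  length (map (outside ∷_) A) + length (map (inside ∷_) B) ≡⟨ cong₂ _+_ (length-map _ A) (length-map _ B) ⟩
  length A + length B                                     ≡⟨ cong₂ _+_ (length-completions π (suc k)) (length-completions π k) ⟩
  #optional π C suc k + #optional π C k                   ≡⟨ +-comm (#optional π C suc k) (#optional π C k) ⟩
  #optional π C k + #optional π C suc k                   ≡⟨ nCk+nC[k+1]≡[n+1]C[k+1] (#optional π) k ⟩
  suc (#optional π) C suc k                               ∎
  where
  open ≡-Reasoning
  A = completions π (suc k)
  B = completions π k

size-completions : ∀ {n} (π : Vec Mark n) k → All (λ T → ∣ T ∣ ≡ #required π + k) (completions π k)
size-completions []              zero    = refl ∷ []
size-completions []              (suc k) = []
size-completions (required  ∷ π) k       = All.map⁺ (All.map (cong suc) (size-completions π k))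
size-completions (forbidden ∷ π) k       = All.map⁺ (size-completions π k)
size-completions (optional  ∷ π) zero    = All.map⁺ (size-completions π zero)
size-completions (optional  ∷ π) (suc k) = All.++⁺ (All.map⁺ (size-completions π (suc k)))
  (All.map⁺ (All.map (λ ∣T∣≡r+k → trans (cong suc ∣T∣≡r+k) (sym (+-suc (#required π) k))) (size-completions π k)))

completions-unique : ∀ {n} (π : Vec Mark n) k → Unique (completions π k)
completions-unique []              zero    = [] ∷ []
completions-unique []              (suc k) = []
completions-unique (required  ∷ π) k       = Unique.map⁺ ∷-injectiveʳ (completions-unique π k)
completions-unique (forbidden ∷ π) k       = Unique.map⁺ ∷-injectiveʳ (completions-unique π k)
completions-unique (optional  ∷ π) zero    = Unique.map⁺ ∷-injectiveʳ (completions-unique π zero)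
completions-unique (optional  ∷ π) (suc k) = Unique.++⁺
  (Unique.map⁺ ∷-injectiveʳ (completions-unique π (suc k)))
  (Unique.map⁺ ∷-injectiveʳ (completions-unique π k))
  outside-inside-disjoint
  where
  outside-inside-disjoint : Disjoint (map (outside ∷_) (completions π (suc k))) (map (inside ∷_) (completions π k))
  outside-inside-disjoint (T∈A , T∈B) with ∈-map⁻ (outside ∷_) T∈A | ∈-map⁻ (inside ∷_) T∈B
  ... | _ , _ , refl | _ , _ , ()

requiredSet⊆completions : ∀ {n} (π : Vec Mark n) k → All (requiredSet π ⊆_) (completions π k)
requiredSet⊆completions []              zero    = ⊆-refl ∷ []
requiredSet⊆completions []              (suc k) = []
requiredSet⊆completions (required  ∷ π) k       = All.map⁺ (All.map s⊆s (requiredSet⊆completions π k))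
requiredSet⊆completions (forbidden ∷ π) k       = All.map⁺ (All.map s⊆s (requiredSet⊆completions π k))
requiredSet⊆completions (optional  ∷ π) zero    = All.map⁺ (All.map s⊆s (requiredSet⊆completions π zero))
requiredSet⊆completions (optional  ∷ π) (suc k) = All.++⁺
  (All.map⁺ (All.map s⊆s (requiredSet⊆completions π (suc k))))
  (All.map⁺ (All.map out⊆ (requiredSet⊆completions π k)))

requiring : ∀ {n} → Fin n → Vec Mark n
requiring fzero    = required ∷ replicate _ optional
requiring (fsuc i) = optional ∷ requiring i

#optional-replicate : ∀ n → #optional (replicate n optional) ≡ n
#optional-replicate zero    = refl
#optional-replicate (suc n) = cong suc (#optional-replicate n)

#required-replicate : ∀ n → #required (replicate n optional) ≡ 0
#required-replicate zero    = refl
#required-replicate (suc n) = #required-replicate n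

#optional-requiring : ∀ {n} (i : Fin (suc n)) → #optional (requiring i) ≡ n
#optional-requiring {n}     fzero    = #optional-replicate n
#optional-requiring {suc n} (fsuc i) = cong suc (#optional-requiring i)

#required-requiring : ∀ {n} (i : Fin n) → #required (requiring i) ≡ 1
#required-requiring {suc n} fzero    = cong suc (#required-replicate n)
#required-requiring         (fsuc i) = #required-requiring i

∈-requiredSet-requiring : ∀ {n} (i : Fin n) → i ∈ requiredSet (requiring i)
∈-requiredSet-requiring fzero    = here
∈-requiredSet-requiring (fsuc i) = there (∈-requiredSet-requiring i)

within : ∀ {n} → Subset n → Vec Mark n
within []              = []
within (inside  ∷ M)   = optional ∷ within M
within (outside ∷ M)   = forbidden ∷ within M

#optional-within : ∀ {n} (M : Subset n) → #optional (within M) ≡ ∣ M ∣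
#optional-within []            = refl
#optional-within (inside  ∷ M) = cong suc (#optional-within M)
#optional-within (outside ∷ M) = #optional-within M

#required-within : ∀ {n} (M : Subset n) → #required (within M) ≡ 0
#required-within []            = refl
#required-within (inside  ∷ M) = #required-within M
#required-within (outside ∷ M) = #required-within M

extend-to-size : ∀ {n k} (S : Subset n) → ∣ S ∣ ≤ k → k ≤ n → ∃ λ S′ → S ⊆ S′ × ∣ S′ ∣ ≡ k
extend-to-size []           z≤n         z≤n       = [] , ⊆-refl , refl
extend-to-size (inside ∷ S) (s≤s ∣S∣≤k) (s≤s k≤n) =
  let S′ , S⊆S′ , ∣S′∣≡k = extend-to-size S ∣S∣≤k k≤n
  in inside ∷ S′ , s⊆s S⊆S′ , cong suc ∣S′∣≡k
extend-to-size {suc n} {k} (outside ∷ S) ∣S∣≤k k≤1+n with k ≤? n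
... | yes k≤n =
  let S′ , S⊆S′ , ∣S′∣≡k = extend-to-size S ∣S∣≤k k≤n
  in outside ∷ S′ , s⊆s S⊆S′ , ∣S′∣≡k
... | no k≰n  = ⊤ , ⊆⊤ , trans (∣⊤∣≡n (suc n)) (≤-antisym (≰⇒> k≰n) k≤1+n)

∃⊎∀ : ∀ {n} {P Q : Fin n → Set} → (∀ i → P i ⊎ Q i) → ∃ P ⊎ (∀ i → Q i)
∃⊎∀ {zero}  _ = inj₂ λ ()
∃⊎∀ {suc n} P⊎Q with P⊎Q fzero | ∃⊎∀ (λ i → P⊎Q (fsuc i))
... | inj₁ p | _              = inj₁ (fzero , p)
... | inj₂ _ | inj₁ (i , p)   = inj₁ (fsuc i , p)
... | inj₂ q | inj₂ ∀q        = inj₂ λ { fzero → q ; (fsuc i) → ∀q i }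

-- Ordered-field arithmetic and sums

module _ (R : RealField) where
  open RealField R renaming (_+_ to _+ᴿ_; _*_ to _*ᴿ_; -_ to -ᴿ_; _≤_ to _≤ᴿ_)
  open Ops R
  open IsTotalOrder isTotalOrder using (total; antisym)
    renaming (refl to ≤ᴿ-refl; trans to ≤ᴿ-trans)

  ℝ-ring : CommutativeRing 0ℓ 0ℓ
  ℝ-ring = record { isCommutativeRing = isCommutativeRing }

  private module ℝ = CommutativeRing ℝ-ring

  ℝ-poset : Poset 0ℓ 0ℓ 0ℓ
  ℝ-poset = record { isPartialOrder = IsTotalOrder.isPartialOrder isTotalOrder }

  module ≤ᴿ-Reasoning = PosetReasoning ℝ-poset
  open import Algebra.Properties.Ring ℝ.ring using (-‿distribˡ-*; -‿distribʳ-*; x[y-z]≈xy-xz)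
  open import Algebra.Properties.Group ℝ.+-group using (⁻¹-involutive)
  open import Algebra.Properties.CommutativeSemigroup ℝ.+-commutativeSemigroup using (x∙yz≈y∙xz)

  +ᴿ-monoʳ-≤ : ∀ z {x y} → x ≤ᴿ y → z +ᴿ x ≤ᴿ z +ᴿ y
  +ᴿ-monoʳ-≤ z {x} {y} x≤y = subst₂ _≤ᴿ_ (ℝ.+-comm x z) (ℝ.+-comm y z) (+-mono-≤ z x≤y)

  +ᴿ-mono-≤ : ∀ {x y u v} → x ≤ᴿ y → u ≤ᴿ v → x +ᴿ u ≤ᴿ y +ᴿ v
  +ᴿ-mono-≤ {y = y} {u} x≤y u≤v = ≤ᴿ-trans (+-mono-≤ u x≤y) (+ᴿ-monoʳ-≤ y u≤v)

  +ᴿ-cancelˡ-≤ : ∀ z {x y} → z +ᴿ x ≤ᴿ z +ᴿ y → x ≤ᴿ y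
  +ᴿ-cancelˡ-≤ z {x} {y} z+x≤z+y = subst₂ _≤ᴿ_ (-z+[z+a]≡a x) (-z+[z+a]≡a y) (+ᴿ-monoʳ-≤ (-ᴿ z) z+x≤z+y)
    where
    -z+[z+a]≡a : ∀ a → -ᴿ z +ᴿ (z +ᴿ a) ≡ a
    -z+[z+a]≡a a = trans (sym (ℝ.+-assoc (-ᴿ z) z a)) (trans (cong (_+ᴿ a) (ℝ.-‿inverseˡ z)) (ℝ.+-identityˡ a))

  x≤y⇒0≤y-x : ∀ {x y} → x ≤ᴿ y → 0# ≤ᴿ y ℝ.- x
  x≤y⇒0≤y-x {x} {y} x≤y = subst (_≤ᴿ y ℝ.- x) (ℝ.-‿inverseʳ x) (+-mono-≤ (-ᴿ x) x≤y)

  0≤y-x⇒x≤y : ∀ {x y} → 0# ≤ᴿ y ℝ.- x → x ≤ᴿ y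
  0≤y-x⇒x≤y {x} {y} 0≤y-x = subst₂ _≤ᴿ_ (ℝ.+-identityˡ x) y-x+x≡y (+-mono-≤ x 0≤y-x)
    where
    y-x+x≡y : y ℝ.- x +ᴿ x ≡ y
    y-x+x≡y = trans (ℝ.+-assoc y (-ᴿ x) x) (trans (cong (y +ᴿ_) (ℝ.-‿inverseˡ x)) (ℝ.+-identityʳ y))

  *ᴿ-monoʳ-≤-nonNeg : ∀ {z x y} → 0# ≤ᴿ z → x ≤ᴿ y → z *ᴿ x ≤ᴿ z *ᴿ y
  *ᴿ-monoʳ-≤-nonNeg {z} {x} {y} 0≤z x≤y =
    0≤y-x⇒x≤y (subst (0# ≤ᴿ_) (x[y-z]≈xy-xz z y x) (*-nonneg 0≤z (x≤y⇒0≤y-x x≤y)))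

  *ᴿ-monoˡ-≤-nonNeg : ∀ {z x y} → 0# ≤ᴿ z → x ≤ᴿ y → x *ᴿ z ≤ᴿ y *ᴿ z
  *ᴿ-monoˡ-≤-nonNeg {z} {x} {y} 0≤z x≤y = subst₂ _≤ᴿ_ (ℝ.*-comm z x) (ℝ.*-comm z y) (*ᴿ-monoʳ-≤-nonNeg 0≤z x≤y)

  0≤x*x : ∀ x → 0# ≤ᴿ x *ᴿ x
  0≤x*x x with total 0# x
  ... | inj₁ 0≤x = *-nonneg 0≤x 0≤x
  ... | inj₂ x≤0 = subst (0# ≤ᴿ_) -x*-x≡x*x (*-nonneg 0≤-x 0≤-x)
    where
    0≤-x : 0# ≤ᴿ -ᴿ x
    0≤-x = subst (0# ≤ᴿ_) (ℝ.+-identityˡ (-ᴿ x)) (x≤y⇒0≤y-x x≤0)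
    -x*-x≡x*x : -ᴿ x *ᴿ -ᴿ x ≡ x *ᴿ x
    -x*-x≡x*x = begin
      -ᴿ x *ᴿ -ᴿ x       ≡⟨ -‿distribˡ-* x (-ᴿ x) ⟨
      -ᴿ (x *ᴿ -ᴿ x)     ≡⟨ cong -ᴿ_ (-‿distribʳ-* x x) ⟨
      -ᴿ (-ᴿ (x *ᴿ x))   ≡⟨ ⁻¹-involutive (x *ᴿ x) ⟩
      x *ᴿ x             ∎
      where open ≡-Reasoning

  0≤1 : 0# ≤ᴿ 1#
  0≤1 = subst (0# ≤ᴿ_) (ℝ.*-identityʳ 1#) (0≤x*x 1#)

  0≤x+y : ∀ {x y} → 0# ≤ᴿ x → 0# ≤ᴿ y → 0# ≤ᴿ x +ᴿ y
  0≤x+y 0≤x 0≤y = subst (_≤ᴿ _) (ℝ.+-identityʳ 0#) (+ᴿ-mono-≤ 0≤x 0≤y)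

  x≤x+y : ∀ {x y} → 0# ≤ᴿ y → x ≤ᴿ x +ᴿ y
  x≤x+y {x} {y} 0≤y = subst (_≤ᴿ x +ᴿ y) (ℝ.+-identityʳ x) (+ᴿ-monoʳ-≤ x 0≤y)

  x≤y+x : ∀ {x y} → 0# ≤ᴿ y → x ≤ᴿ y +ᴿ x
  x≤y+x {x} {y} 0≤y = subst (_≤ᴿ y +ᴿ x) (ℝ.+-identityˡ x) (+-mono-≤ x 0≤y)

  0≤fromℕ : ∀ n → 0# ≤ᴿ fromℕ n
  0≤fromℕ zero    = ≤ᴿ-refl
  0≤fromℕ (suc n) = 0≤x+y 0≤1 (0≤fromℕ n)

  fromℕ-mono-≤ : ∀ {a b} → a ≤ b → fromℕ a ≤ᴿ fromℕ b
  fromℕ-mono-≤ {b = b} z≤n   = 0≤fromℕ b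
  fromℕ-mono-≤ (s≤s a≤b)     = +ᴿ-monoʳ-≤ 1# (fromℕ-mono-≤ a≤b)

  fromℕ-+ : ∀ a b → fromℕ (a + b) ≡ fromℕ a +ᴿ fromℕ b
  fromℕ-+ zero    b = sym (ℝ.+-identityˡ (fromℕ b))
  fromℕ-+ (suc a) b = trans (cong (1# +ᴿ_) (fromℕ-+ a b)) (sym (ℝ.+-assoc 1# (fromℕ a) (fromℕ b)))

  fromℕ-suc-* : ∀ a x → fromℕ (suc a) *ᴿ x ≡ x +ᴿ fromℕ a *ᴿ x
  fromℕ-suc-* a x = trans (ℝ.distribʳ x 1# (fromℕ a)) (cong (_+ᴿ fromℕ a *ᴿ x) (ℝ.*-identityˡ x))

  fromℕ-+-* : ∀ a b x → fromℕ (a + b) *ᴿ x ≡ fromℕ a *ᴿ x +ᴿ fromℕ b *ᴿ x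
  fromℕ-+-* a b x = trans (cong (_*ᴿ x) (fromℕ-+ a b)) (ℝ.distribʳ x (fromℕ a) (fromℕ b))

  fromℕ-* : ∀ a b → fromℕ (a * b) ≡ fromℕ a *ᴿ fromℕ b
  fromℕ-* zero    b = sym (ℝ.zeroˡ (fromℕ b))
  fromℕ-* (suc a) b = begin
    fromℕ (b + a * b)                ≡⟨ fromℕ-+ b (a * b) ⟩
    fromℕ b +ᴿ fromℕ (a * b)         ≡⟨ cong (fromℕ b +ᴿ_) (fromℕ-* a b) ⟩
    fromℕ b +ᴿ fromℕ a *ᴿ fromℕ b    ≡⟨ fromℕ-suc-* a (fromℕ b) ⟨
    fromℕ (suc a) *ᴿ fromℕ b         ∎
    where open ≡-Reasoning

  fromℕ-*-≤⇒≡0 : ∀ {a b x} → b < a → 0# ≤ᴿ x → fromℕ a *ᴿ x ≤ᴿ fromℕ b *ᴿ x → x ≡ 0#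
  fromℕ-*-≤⇒≡0 {a} {b} {x} b<a 0≤x ax≤bx = antisym x≤0 0≤x
    where
    d = a ∸ suc b
    ax≡bx+[x+dx] : fromℕ a *ᴿ x ≡ fromℕ b *ᴿ x +ᴿ (x +ᴿ fromℕ d *ᴿ x)
    ax≡bx+[x+dx] = begin
      fromℕ a *ᴿ x                               ≡⟨ cong (λ n → fromℕ n *ᴿ x) (trans (+-suc b d) (m+[n∸m]≡n b<a)) ⟨
      fromℕ (b + suc d) *ᴿ x                     ≡⟨ fromℕ-+-* b (suc d) x ⟩
      fromℕ b *ᴿ x +ᴿ fromℕ (suc d) *ᴿ x         ≡⟨ cong (fromℕ b *ᴿ x +ᴿ_) (fromℕ-suc-* d x) ⟩
      fromℕ b *ᴿ x +ᴿ (x +ᴿ fromℕ d *ᴿ x)        ∎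
      where open ≡-Reasoning
    x+dx≤0 : x +ᴿ fromℕ d *ᴿ x ≤ᴿ 0#
    x+dx≤0 = +ᴿ-cancelˡ-≤ (fromℕ b *ᴿ x)
      (subst₂ _≤ᴿ_ ax≡bx+[x+dx] (sym (ℝ.+-identityʳ (fromℕ b *ᴿ x))) ax≤bx)
    x≤0 : x ≤ᴿ 0#
    x≤0 = ≤ᴿ-trans (x≤x+y (*-nonneg (0≤fromℕ d) 0≤x)) x+dx≤0

  sumOver-nonNeg : ∀ {n} (T : Subset n) {f : Fin n → Carrier} → (∀ i → 0# ≤ᴿ f i) → 0# ≤ᴿ sumOver T f
  sumOver-nonNeg []            _     = ≤ᴿ-refl
  sumOver-nonNeg (inside ∷ T)  0≤f   = 0≤x+y (0≤f fzero) (sumOver-nonNeg T (λ i → 0≤f (fsuc i)))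
  sumOver-nonNeg (outside ∷ T) 0≤f   = sumOver-nonNeg T (λ i → 0≤f (fsuc i))

  ∈⇒≤sumOver : ∀ {n} {T : Subset n} {f : Fin n → Carrier} {i} → (∀ j → 0# ≤ᴿ f j) → i ∈ T → f i ≤ᴿ sumOver T f
  ∈⇒≤sumOver {T = inside ∷ T}  0≤f here        = x≤x+y (sumOver-nonNeg T (λ j → 0≤f (fsuc j)))
  ∈⇒≤sumOver {T = inside ∷ T}  0≤f (there i∈T) = ≤ᴿ-trans (∈⇒≤sumOver (λ j → 0≤f (fsuc j)) i∈T) (x≤y+x (0≤f fzero))
  ∈⇒≤sumOver {T = outside ∷ T} 0≤f (there i∈T) = ∈⇒≤sumOver (λ j → 0≤f (fsuc j)) i∈T

  *-sumOver-≤ : ∀ {n} (T : Subset n) {f : Fin n → Carrier} {c y} → (∀ i → c *ᴿ f i ≤ᴿ y) →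
                c *ᴿ sumOver T f ≤ᴿ fromℕ ∣ T ∣ *ᴿ y
  *-sumOver-≤ []            {c = c} {y} _ = subst₂ _≤ᴿ_ (sym (ℝ.zeroʳ c)) (sym (ℝ.zeroˡ y)) ≤ᴿ-refl
  *-sumOver-≤ (inside ∷ T)  {f} {c} {y} cf≤y =
    subst₂ _≤ᴿ_ (sym (ℝ.distribˡ c (f fzero) _)) (sym (fromℕ-suc-* ∣ T ∣ y))
      (+ᴿ-mono-≤ (cf≤y fzero) (*-sumOver-≤ T (λ i → cf≤y (fsuc i))))
  *-sumOver-≤ (outside ∷ T) cf≤y = *-sumOver-≤ T (λ i → cf≤y (fsuc i))

  sumOver-support : ∀ {n} (S : Subset n) {f : Fin n → Carrier} → (∀ i → i ∉ S → f i ≡ 0#) → sumOver S f ≡ sumAll f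
  sumOver-support []            _       = refl
  sumOver-support (inside ∷ S)  {f} f≡0 =
    cong (f fzero +ᴿ_) (sumOver-support S (λ i i∉S → f≡0 (fsuc i) λ { (there i∈S) → i∉S i∈S }))
  sumOver-support (outside ∷ S) {f} f≡0 = begin
    sumOver S (λ i → f (fsuc i))                   ≡⟨ sumOver-support S (λ i i∉S → f≡0 (fsuc i) λ { (there i∈S) → i∉S i∈S }) ⟩
    sumAll (λ i → f (fsuc i))                      ≡⟨ ℝ.+-identityˡ _ ⟨
    0# +ᴿ sumAll (λ i → f (fsuc i))                ≡⟨ cong (_+ᴿ sumAll (λ i → f (fsuc i))) (f≡0 fzero λ ()) ⟨
    f fzero +ᴿ sumAll (λ i → f (fsuc i))           ∎
    where open ≡-Reasoning

  ∣∣≡0⇒sumOver≡0 : ∀ {n} (S : Subset n) {f : Fin n → Carrier} → ∣ S ∣ ≡ 0 → sumOver S f ≡ 0#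
  ∣∣≡0⇒sumOver≡0 []            _      = refl
  ∣∣≡0⇒sumOver≡0 (outside ∷ S) ∣S∣≡0  = ∣∣≡0⇒sumOver≡0 S ∣S∣≡0

  sumList : ∀ {A : Set} → (A → Carrier) → List A → Carrier
  sumList h []       = 0#
  sumList h (x ∷ xs) = h x +ᴿ sumList h xs

  sumList-++ : ∀ {A : Set} (h : A → Carrier) xs ys → sumList h (xs ++ ys) ≡ sumList h xs +ᴿ sumList h ys
  sumList-++ h []       ys = sym (ℝ.+-identityˡ (sumList h ys))
  sumList-++ h (x ∷ xs) ys = trans (cong (h x +ᴿ_) (sumList-++ h xs ys)) (sym (ℝ.+-assoc (h x) _ _))

  sumList-map : ∀ {A B : Set} (h : B → Carrier) (g : A → B) xs → sumList h (map g xs) ≡ sumList (λ x → h (g x)) xs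
  sumList-map h g []       = refl
  sumList-map h g (x ∷ xs) = cong (h (g x) +ᴿ_) (sumList-map h g xs)

  sumList-const-+ : ∀ {A : Set} (c : Carrier) (h : A → Carrier) xs →
                    sumList (λ x → c +ᴿ h x) xs ≡ fromℕ (length xs) *ᴿ c +ᴿ sumList h xs
  sumList-const-+ c h []       = sym (trans (cong (_+ᴿ 0#) (ℝ.zeroˡ c)) (ℝ.+-identityʳ 0#))
  sumList-const-+ c h (x ∷ xs) = begin
    c +ᴿ h x +ᴿ sumList (λ x → c +ᴿ h x) xs              ≡⟨ cong (c +ᴿ h x +ᴿ_) (sumList-const-+ c h xs) ⟩
    c +ᴿ h x +ᴿ (fromℕ (length xs) *ᴿ c +ᴿ sumList h xs)  ≡⟨ ℝ.+-assoc c (h x) _ ⟩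
    c +ᴿ (h x +ᴿ (ℓc +ᴿ sumList h xs))                    ≡⟨ cong (c +ᴿ_) (x∙yz≈y∙xz (h x) ℓc _) ⟩
    c +ᴿ (ℓc +ᴿ (h x +ᴿ sumList h xs))                    ≡⟨ ℝ.+-assoc c ℓc _ ⟨
    c +ᴿ ℓc +ᴿ (h x +ᴿ sumList h xs)                      ≡⟨ cong (_+ᴿ (h x +ᴿ sumList h xs)) (fromℕ-suc-* (length xs) c) ⟨
    fromℕ (suc (length xs)) *ᴿ c +ᴿ (h x +ᴿ sumList h xs) ∎
    where
    open ≡-Reasoning
    ℓc = fromℕ (length xs) *ᴿ c

  *-+-≤ : ∀ {c u w y p q} → c *ᴿ u ≤ᴿ fromℕ p *ᴿ y → c *ᴿ w ≤ᴿ fromℕ q *ᴿ y →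
          c *ᴿ (u +ᴿ w) ≤ᴿ fromℕ (p + q) *ᴿ y
  *-+-≤ {c} {u} {w} {y} {p} {q} cu≤py cw≤qy =
    subst₂ _≤ᴿ_ (sym (ℝ.distribˡ c u w)) (sym (fromℕ-+-* p q y)) (+ᴿ-mono-≤ cu≤py cw≤qy)

  *-sumList-≤-filter : ∀ {A : Set} {P : A → Set} (P? : Decidable P) (h : A → Carrier) {c y a b} {xs : List A} →
    All (λ x → c *ᴿ h x ≤ᴿ fromℕ (a + b) *ᴿ y) xs →
    All (λ x → ¬ P x → c *ᴿ h x ≤ᴿ fromℕ b *ᴿ y) xs →
    c *ᴿ sumList h xs ≤ᴿ fromℕ (length (filter P? xs) * a + length xs * b) *ᴿ y
  *-sumList-≤-filter P? h {c} {y} {xs = []} [] [] =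
    subst₂ _≤ᴿ_ (sym (ℝ.zeroʳ c)) (sym (ℝ.zeroˡ y)) ≤ᴿ-refl
  *-sumList-≤-filter P? h {c} {y} {a} {b} {x ∷ xs} (chx≤[a+b]y ∷ bounds) (chx≤by ∷ bounds¬P)
    with P? x
  ... | yes _  = subst (λ n → c *ᴿ sumList h (x ∷ xs) ≤ᴿ fromℕ n *ᴿ y) (regroup-accept (length (filter P? xs)) (length xs) a b)
                   (*-+-≤ {p = a + b} chx≤[a+b]y (*-sumList-≤-filter P? h {a = a} {b} bounds bounds¬P))
    where
    regroup-accept : ∀ g l a b → a + b + (g * a + l * b) ≡ suc g * a + suc l * b
    regroup-accept = solve-∀
  ... | no ¬Px = subst (λ n → c *ᴿ sumList h (x ∷ xs) ≤ᴿ fromℕ n *ᴿ y) (regroup-reject (length (filter P? xs)) (length xs) a b)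
                   (*-+-≤ {p = b} (chx≤by ¬Px) (*-sumList-≤-filter P? h {a = a} {b} bounds bounds¬P))
    where
    regroup-reject : ∀ g l a b → b + (g * a + l * b) ≡ g * a + suc l * b
    regroup-reject = solve-∀

  sumList-sumOver-within-zero : ∀ {n} (M : Subset n) (f : Fin n → Carrier) →
    sumList (λ T → sumOver T f) (completions (within M) 0) ≡ 0#
  sumList-sumOver-within-zero []            f = ℝ.+-identityʳ 0#
  sumList-sumOver-within-zero (inside ∷ M)  f =
    trans (sumList-map (λ T → sumOver T f) (outside ∷_) (completions (within M) 0))
          (sumList-sumOver-within-zero M (λ i → f (fsuc i)))
  sumList-sumOver-within-zero (outside ∷ M) f =
    trans (sumList-map (λ T → sumOver T f) (outside ∷_) (completions (within M) 0))
          (sumList-sumOver-within-zero M (λ i → f (fsuc i)))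

  -- When M is empty the sum W vanishes, so Pascal's rule is only needed for ∣ M ∣ ≥ 1.
  fromℕ-Pascal-pred : ∀ n k {W} → (n ≡ 0 → W ≡ 0#) →
    fromℕ ((n ∸ 1) C suc k) *ᴿ W +ᴿ fromℕ ((n ∸ 1) C k) *ᴿ W ≡ fromℕ (n C suc k) *ᴿ W
  fromℕ-Pascal-pred zero    k {W} W≡0 = begin
    fromℕ (0 C suc k) *ᴿ W +ᴿ fromℕ (0 C k) *ᴿ W ≡⟨ cong₂ _+ᴿ_ (ℝ.zeroˡ W) (cong (fromℕ (0 C k) *ᴿ_) (W≡0 refl)) ⟩
    0# +ᴿ fromℕ (0 C k) *ᴿ 0#                    ≡⟨ ℝ.+-identityˡ _ ⟩
    fromℕ (0 C k) *ᴿ 0#                          ≡⟨ ℝ.zeroʳ _ ⟩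
    0#                                           ≡⟨ ℝ.zeroˡ W ⟨
    fromℕ (0 C suc k) *ᴿ W                       ∎
    where open ≡-Reasoning
  fromℕ-Pascal-pred (suc n) k {W} _ = begin
    fromℕ (n C suc k) *ᴿ W +ᴿ fromℕ (n C k) *ᴿ W   ≡⟨ ℝ.+-comm _ _ ⟩
    fromℕ (n C k) *ᴿ W +ᴿ fromℕ (n C suc k) *ᴿ W   ≡⟨ fromℕ-+-* (n C k) (n C suc k) W ⟨
    fromℕ (n C k + n C suc k) *ᴿ W                 ≡⟨ cong (λ a → fromℕ a *ᴿ W) (nCk+nC[k+1]≡[n+1]C[k+1] n k) ⟩
    fromℕ (suc n C suc k) *ᴿ W                     ∎
    where open ≡-Reasoning

  sumList-sumOver-within : ∀ {n} (M : Subset n) k (f : Fin n → Carrier) →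
    sumList (λ T → sumOver T f) (completions (within M) (suc k)) ≡ fromℕ ((∣ M ∣ ∸ 1) C k) *ᴿ sumOver M f

  sumList-sumOver-within-Pascal : ∀ {n} (M : Subset n) k (f : Fin n → Carrier) →
    fromℕ ((∣ M ∣ ∸ 1) C k) *ᴿ sumOver M f +ᴿ sumList (λ T → sumOver T f) (completions (within M) k)
      ≡ fromℕ (∣ M ∣ C k) *ᴿ sumOver M f
  sumList-sumOver-within-Pascal M zero    f =
    trans (cong (fromℕ 1 *ᴿ sumOver M f +ᴿ_) (sumList-sumOver-within-zero M f)) (ℝ.+-identityʳ _)
  sumList-sumOver-within-Pascal M (suc k) f =
    trans (cong (fromℕ ((∣ M ∣ ∸ 1) C suc k) *ᴿ sumOver M f +ᴿ_) (sumList-sumOver-within M k f))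
          (fromℕ-Pascal-pred ∣ M ∣ k (∣∣≡0⇒sumOver≡0 M))

  sumList-sumOver-within []            k f = sym (ℝ.zeroʳ _)
  sumList-sumOver-within (outside ∷ M) k f =
    trans (sumList-map (λ T → sumOver T f) (outside ∷_) (completions (within M) (suc k)))
          (sumList-sumOver-within M k (λ i → f (fsuc i)))
  sumList-sumOver-within (inside ∷ M)  k f = begin
    Σ (map (outside ∷_) A ++ map (inside ∷_) B)                     ≡⟨ sumList-++ (λ T → sumOver T f) (map (outside ∷_) A) _ ⟩
    Σ (map (outside ∷_) A) +ᴿ Σ (map (inside ∷_) B)                 ≡⟨ cong₂ _+ᴿ_ (sumList-map (λ T → sumOver T f) (outside ∷_) A)
                                                                                  (sumList-map (λ T → sumOver T f) (inside ∷_) B) ⟩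
    Σ′ A +ᴿ sumList (λ T → f₀ +ᴿ sumOver T f′) B                    ≡⟨ cong₂ _+ᴿ_ (sumList-sumOver-within M k f′) (sumList-const-+ f₀ (λ T → sumOver T f′) B) ⟩
    fromℕ (p C k) *ᴿ W +ᴿ (fromℕ (length B) *ᴿ f₀ +ᴿ Σ′ B)         ≡⟨ cong (λ ℓ → fromℕ (p C k) *ᴿ W +ᴿ (fromℕ ℓ *ᴿ f₀ +ᴿ Σ′ B)) length-B ⟩
    fromℕ (p C k) *ᴿ W +ᴿ (fromℕ (∣ M ∣ C k) *ᴿ f₀ +ᴿ Σ′ B)        ≡⟨ x∙yz≈y∙xz (fromℕ (p C k) *ᴿ W) _ _ ⟩
    fromℕ (∣ M ∣ C k) *ᴿ f₀ +ᴿ (fromℕ (p C k) *ᴿ W +ᴿ Σ′ B)        ≡⟨ cong (fromℕ (∣ M ∣ C k) *ᴿ f₀ +ᴿ_) (sumList-sumOver-within-Pascal M k f′) ⟩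
    fromℕ (∣ M ∣ C k) *ᴿ f₀ +ᴿ fromℕ (∣ M ∣ C k) *ᴿ W              ≡⟨ ℝ.distribˡ (fromℕ (∣ M ∣ C k)) f₀ W ⟨
    fromℕ (∣ M ∣ C k) *ᴿ (f₀ +ᴿ W)                                 ∎
    where
    open ≡-Reasoning
    A = completions (within M) (suc k)
    B = completions (within M) k
    p = ∣ M ∣ ∸ 1
    f₀ = f fzero
    f′ = λ i → f (fsuc i)
    W = sumOver M f′
    Σ Σ′ : List (Subset _) → Carrier
    Σ  = sumList (λ T → sumOver T f)
    Σ′ = sumList (λ T → sumOver T f′)
    length-B : length B ≡ ∣ M ∣ C k
    length-B = trans (length-completions (within M) k) (cong (_C k) (#optional-within M))

  -- Heavy sets

  IsHeavy : ∀ {m} → ℕ → ℕ → (Fin m → Carrier) → Subset m → Set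
  IsHeavy s t v T = ∣ T ∣ ≡ t × fromℕ t *ᴿ normSq v ≤ᴿ fromℕ (2 * s) *ᴿ sumOver T (λ i → v i *ᴿ v i)

  HeavySets : ∀ {m} → ℕ → ℕ → (Fin m → Carrier) → (ℕ → Set) → Set
  HeavySets {m} s t v Enough = ∃ λ (Ts : List (Subset m)) → Unique Ts × All (IsHeavy s t v) Ts × Enough (length Ts)

  HeavyCoordinate LightCoordinate : ∀ {m} → ℕ → ℕ → (Fin m → Carrier) → Fin m → Set
  HeavyCoordinate s t v i = fromℕ t *ᴿ normSq v ≤ᴿ fromℕ (2 * s) *ᴿ (v i *ᴿ v i)
  LightCoordinate s t v i = fromℕ (2 * s) *ᴿ (v i *ᴿ v i) ≤ᴿ fromℕ t *ᴿ normSq v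

  ∃heavy⊎∀light : ∀ {m} s t (v : Fin m → Carrier) → ∃ (HeavyCoordinate s t v) ⊎ (∀ i → LightCoordinate s t v i)
  ∃heavy⊎∀light s t v = ∃⊎∀ (λ i → total (fromℕ t *ᴿ normSq v) (fromℕ (2 * s) *ᴿ (v i *ᴿ v i)))

  normSq≡0⇒heavyCoordinate : ∀ {m s t} {v : Fin m → Carrier} → normSq v ≡ 0# → ∀ i → HeavyCoordinate s t v i
  normSq≡0⇒heavyCoordinate {s = s} {t} {v} ‖v‖²≡0 i =
    subst (_≤ᴿ fromℕ (2 * s) *ᴿ (v i *ᴿ v i)) (sym (trans (cong (fromℕ t *ᴿ_) ‖v‖²≡0) (ℝ.zeroʳ (fromℕ t))))
      (*-nonneg (0≤fromℕ (2 * s)) (0≤x*x (v i)))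

  heavyCoordinate⇒heavySets : ∀ {m s k} (v : Fin m → Carrier) (i : Fin m) → HeavyCoordinate s (suc k) v i →
                              HeavySets s (suc k) v (_≡ (m ∸ 1) C k)
  heavyCoordinate⇒heavySets {suc m} {s} {k} v i heavy-i =
    completions (requiring i) k ,
    completions-unique (requiring i) k ,
    All.zipWith heavy (size-completions (requiring i) k , requiredSet⊆completions (requiring i) k) ,
    trans (length-completions (requiring i) k) (cong (_C k) (#optional-requiring i))
    where
    heavy : ∀ {T} → ∣ T ∣ ≡ #required (requiring i) + k × requiredSet (requiring i) ⊆ T → IsHeavy s (suc k) v T
    heavy (∣T∣≡1+k , i∈T) =
      trans ∣T∣≡1+k (cong (_+ k) (#required-requiring i)) ,
      ≤ᴿ-trans heavy-i (*ᴿ-monoʳ-≤-nonNeg (0≤fromℕ (2 * s))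
        (∈⇒≤sumOver (λ j → 0≤x*x (v j)) (i∈T (∈-requiredSet-requiring i))))

  -- Only a choice, not a decision of _≤ᴿ_: when x and y are equal, `total` may pick either side.
  ≤ᴿ-choice : Carrier → Carrier → Bool
  ≤ᴿ-choice x y = [ const true , const false ]′ (total x y)

  ≤ᴿ-choice-sound : ∀ x y → T (≤ᴿ-choice x y) → x ≤ᴿ y
  ≤ᴿ-choice-sound x y chosen with total x y
  ... | inj₁ x≤y = x≤y
  ... | inj₂ _   = ⊥-elim chosen

  ≤ᴿ-choice-complete : ∀ x y → ¬ T (≤ᴿ-choice x y) → y ≤ᴿ x
  ≤ᴿ-choice-complete x y ¬chosen with total x y
  ... | inj₁ _   = ⊥-elim (¬chosen tt)
  ... | inj₂ y≤x = y≤x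

  spread⇒heavySets : ∀ {m s k} (v : Fin m → Carrier) (S : Subset m) →
    ∣ S ∣ ≡ s → (∀ i → i ∉ S → v i ≡ 0#) → suc k ≤ s → (∀ i → LightCoordinate s (suc k) v i) →
    HeavySets s (suc k) v (λ ℓ → s ^ suc k ≤ (8 * suc k) ^ suc k * ℓ) ⊎ normSq v ≡ 0#
  spread⇒heavySets {s = suc s′} {k} v S ∣S∣≡s vanishes t≤s spread = conclude (K ≤? g * t)
    where
    s = suc s′
    t = suc k
    K = s C t
    w = λ i → v i *ᴿ v i
    N = normSq v
    c = fromℕ (2 * s)
    σ = λ U → sumOver U w
    L = completions (within S) t
    heavy? : Decidable (λ U → T (≤ᴿ-choice (fromℕ t *ᴿ N) (c *ᴿ σ U)))
    heavy? U = T? (≤ᴿ-choice (fromℕ t *ᴿ N) (c *ᴿ σ U))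
    G = filter heavy? L
    g = length G

    sizes : All (λ U → ∣ U ∣ ≡ t) L
    sizes = All.map (λ ∣U∣≡r+t → trans ∣U∣≡r+t (cong (_+ t) (#required-within S))) (size-completions (within S) t)

    length-L : length L ≡ K
    length-L = trans (length-completions (within S) t) (cong (_C t) (trans (#optional-within S) ∣S∣≡s))

    ΣS≡N : sumOver S w ≡ N
    ΣS≡N = sumOver-support S (λ i i∉S → trans (cong (λ x → x *ᴿ x) (vanishes i i∉S)) (ℝ.zeroˡ 0#))

    0≤N : 0# ≤ᴿ N
    0≤N = subst (0# ≤ᴿ_) ΣS≡N (sumOver-nonNeg S (λ i → 0≤x*x (v i)))

    double-count : c *ᴿ sumList σ L ≡ fromℕ (2 * (t * K)) *ᴿ N
    double-count = begin
      c *ᴿ sumList σ L                           ≡⟨ cong (c *ᴿ_) (sumList-sumOver-within S k w) ⟩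
      c *ᴿ (fromℕ ((∣ S ∣ ∸ 1) C k) *ᴿ sumOver S w) ≡⟨ cong₂ (λ a x → c *ᴿ (fromℕ ((a ∸ 1) C k) *ᴿ x)) ∣S∣≡s ΣS≡N ⟩
      c *ᴿ (fromℕ (s′ C k) *ᴿ N)                 ≡⟨ ℝ.*-assoc c (fromℕ (s′ C k)) N ⟨
      c *ᴿ fromℕ (s′ C k) *ᴿ N                   ≡⟨ cong (_*ᴿ N) (fromℕ-* (2 * s) (s′ C k)) ⟨
      fromℕ (2 * s * (s′ C k)) *ᴿ N              ≡⟨ cong (λ a → fromℕ a *ᴿ N) (*-assoc 2 s (s′ C k)) ⟩
      fromℕ (2 * (s * (s′ C k))) *ᴿ N            ≡⟨ cong (λ a → fromℕ (2 * a) *ᴿ N) (C-absorption s′ k) ⟨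
      fromℕ (2 * (t * K)) *ᴿ N                   ∎
      where open ≡-Reasoning

    bound : c *ᴿ sumList σ L ≤ᴿ fromℕ (g * (t * t) + K * t) *ᴿ N
    bound = subst (λ ℓ → c *ᴿ sumList σ L ≤ᴿ fromℕ (g * (t * t) + ℓ * t) *ᴿ N) length-L
      (*-sumList-≤-filter heavy? σ {a = t * t} (All.map (λ {U} → size-bound {U}) sizes) (All.tabulate (λ {U} _ → ≤ᴿ-choice-complete _ _)))
      where
      size-bound : ∀ {U} → ∣ U ∣ ≡ t → c *ᴿ σ U ≤ᴿ fromℕ (t * t + t) *ᴿ N
      size-bound {U} ∣U∣≡t = begin
        c *ᴿ σ U                      ≤⟨ *-sumOver-≤ U spread ⟩
        fromℕ ∣ U ∣ *ᴿ (fromℕ t *ᴿ N)  ≡⟨ cong (λ a → fromℕ a *ᴿ (fromℕ t *ᴿ N)) ∣U∣≡t ⟩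
        fromℕ t *ᴿ (fromℕ t *ᴿ N)      ≡⟨ ℝ.*-assoc (fromℕ t) (fromℕ t) N ⟨
        fromℕ t *ᴿ fromℕ t *ᴿ N        ≡⟨ cong (_*ᴿ N) (fromℕ-* t t) ⟨
        fromℕ (t * t) *ᴿ N             ≤⟨ *ᴿ-monoˡ-≤-nonNeg 0≤N (fromℕ-mono-≤ (m≤m+n (t * t) t)) ⟩
        fromℕ (t * t + t) *ᴿ N         ∎
        where open ≤ᴿ-Reasoning

    conclude : Dec (K ≤ g * t) → HeavySets s t v (λ ℓ → s ^ t ≤ (8 * t) ^ t * ℓ) ⊎ N ≡ 0#
    conclude (yes K≤gt) = inj₁ (G , Unique.filter⁺ heavy? (completions-unique (within S) t) ,
                               All.zipWith (λ (∣U∣≡t , chosen) → ∣U∣≡t , ≤ᴿ-choice-sound _ _ chosen)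
                                           (All.filter⁺ heavy? sizes , All.all-filter heavy? L) ,
                               s^t≤[8t]^t*g t≤s K≤gt)
    conclude (no K≰gt)  = inj₂ (fromℕ-*-≤⇒≡0 (gt<K⇒gt²+Kt<2tK {g} t (≰⇒> K≰gt)) 0≤N (subst (_≤ᴿ fromℕ (g * (t * t) + K * t) *ᴿ N) double-count bound))


lemma4p1 : (R : RealField) (m s t : ℕ) (v : Fin m → RealField.Carrier R) →
           (∃ λ (S : Subset m) → ∣ S ∣ ≤ s × (∀ i → i ∉ S → v i ≡ RealField.0# R)) →
           2 * s ≤ m → 1 ≤ t → 8 * t ≤ s →
           ∃ λ (Ts : List (Subset m)) →
             Unique Ts
             × All (λ T → ∣ T ∣ ≡ t
                          × RealField._≤_ R
                              (RealField._*_ R (Ops.fromℕ R t) (Ops.normSq R v))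
                              (RealField._*_ R (Ops.fromℕ R (2 * s))
                                 (Ops.sumOver R T (λ i → RealField._*_ R (v i) (v i)))))
                   Ts
             × ((m ∸ 1) C (t ∸ 1) ≤ length Ts ⊎ s ^ t ≤ (8 * t) ^ t * length Ts)
lemma4p1 R m s t@(suc k) v (S , ∣S∣≤s , vanishes) 2s≤m (s≤s z≤n) 8t≤s =
  [ fromHeavyCoordinate , fromSpread ]′ (∃heavy⊎∀light R s t v)
  where
  Enough : ℕ → Set
  Enough ℓ = (m ∸ 1) C k ≤ ℓ ⊎ s ^ t ≤ (8 * t) ^ t * ℓ

  s≤m : s ≤ m
  s≤m = ≤-trans (m≤n*m s 2) 2s≤m

  t≤s : t ≤ s
  t≤s = ≤-trans (m≤n*m t 8) 8t≤s

  fromHeavyCoordinate : ∃ (HeavyCoordinate R s t v) → HeavySets R s t v Enough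
  fromHeavyCoordinate (i , heavy) with heavyCoordinate⇒heavySets R {s = s} {k} v i heavy
  ... | Ts , unique , heavySets , ℓ≡ = Ts , unique , heavySets , inj₁ (≤-reflexive (sym ℓ≡))

  fromZeroVector : Ops.normSq R v ≡ RealField.0# R → HeavySets R s t v Enough
  fromZeroVector ‖v‖²≡0 = fromHeavyCoordinate (i₀ , normSq≡0⇒heavyCoordinate R {s = s} {t} ‖v‖²≡0 i₀)
    where
    i₀ : Fin m
    i₀ = fromℕ< (≤-trans (s≤s z≤n) (≤-trans t≤s s≤m))

  fromSpread : (∀ i → LightCoordinate R s t v i) → HeavySets R s t v Enough
  fromSpread light with extend-to-size S ∣S∣≤s s≤m
  ... | S′ , S⊆S′ , ∣S′∣≡s
      with spread⇒heavySets R {s = s} {k} v S′ ∣S′∣≡s (λ i i∉S′ → vanishes i (i∉S′ ∘ S⊆S′)) t≤s light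
  ...   | inj₁ (Ts , unique , heavySets , bound) = Ts , unique , heavySets , inj₂ bound
  ...   | inj₂ ‖v‖²≡0                            = fromZeroVector ‖v‖²≡0
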